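{- Let $G=(V,E)$ be a finite graph with $n=|V|$ nodes having a perfect matching $M^*$. For each $i\in\{1,\dots,6\}$, every $(\rho,x)\in Q$ is produced using rule $\mathsf{R}(i)$ by at most one $(\sigma,u)\in R_n$.
   Context: Ranking: given a bijection $\sigma:V\to[n]$ (permutation; $\sigma(u)$ is the rank of $u$), list all unordered pairs of distinct nodes lexicographically by $\sigma$ (write each pair $\{a,b\}$ with $\sigma(a)<\sigma(b)$; $\{a_1,b_1\}$ precedes $\{a_2,b_2\}$ iff $\sigma(a_1)<\sigma(a_2)$, or $a_1=a_2$ and $\sigma(b_1)<\sigma(b_2)$), and probe them in this order: when $\{a,b\}$ is probed, if both are unmatched and $\{a,b\}\in E$, match them to each other. The resulting matching is $M(\sigma)$; "matched in $\sigma$", "partner in $\sigma$" refer to $M(\sigma)$. For $u\in V$, $u^*$ denotes the partner of $u$ in the fixed perfect matching $M^*$. $\Omega$ is the set of all permutations. $\sigma_u^i$ is obtained from $\sigma$ by removing $u$ (keeping the relative order of the other nodes) and reinserting $u$ at rank $i$. $Q=\{(\sigma,v):\sigma\in\Omega,\ v\text{ matched in }\sigma\}$; $R_n=\{(\sigma,u):\sigma\in\Omega,\ \sigma(u)=n,\ u\text{ unmatched in }\sigma\}$. Rules: for $(\sigma,u)\in R_n$ and each $i\in[n]$, consider $\sigma_u^i$. If $u$ is unmatched in $\sigma_u^i$ (then $u^*$ is matched): $\mathsf{R}(1)$ produces $(\sigma_u^i,u^*)$; $\mathsf{R}(2)$ produces $(\sigma_u^i,v)$ where $v$ is the partner of $u^*$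 in $\sigma_u^i$. If $u$ is matched in $\sigma_u^i$: $\mathsf{R}(3)$ produces $(\sigma_u^i,u)$; moreover (a) if $u^*$ is matched to $u$ in $\sigma_u^i$, $\mathsf{R}(4)$ produces $(\sigma_u^i,u^*)$; (b) if $u^*$ is matched to some $v\ne u$ in $\sigma_u^i$, $\mathsf{R}(5)$ produces $(\sigma_u^i,v)$; (c) if $u^*$ is unmatched in $\sigma_u^i$, $\mathsf{R}(6)$ produces $(\sigma_u^i,v_o)$ where $v_o$ is the partner of $u^*$ in $\sigma$. Each produced instance lies in $Q$. "$(\rho,x)$ is produced using $\mathsf{R}(i)$ by $(\sigma,u)$" means that for some $j\in[n]$, rule $\mathsf{R}(i)$ applies to $\sigma_u^j$ and produces $(\rho,x)$. -}

module Defs where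

open import Data.Nat using (ℕ; zero; suc)
open import Data.Fin using (Fin; _≟_)
open import Data.Bool using (Bool; true; false; if_then_else_; _∧_)
open import Data.Maybe using (Maybe; just; nothing; is-nothing)
open import Data.List using (List; []; _∷_; _++_; map; foldl; filter)
open import Data.Product using (_×_; _,_; Σ; ∃)
open import Relation.Nullary using (¬_; does)
open import Relation.Nullary.Decidable using (⌊_⌋)
open import Relation.Binary.PropositionalEquality using (_≡_; _≢_)

-- Nodes are Fin n.  A graph is given by a Bool-valued adjacency matrix.
-- A ranking sigma is represented by the list of all nodes in order of
-- increasing rank (position k in the list = rank k+1).

Mate : ℕ → Set
Mate n = Fin n → Maybe (Fin n)

-- all unordered pairs {a,b} listed lexicographically by rank,
-- each written (a , b) with rank a < rank b
pairs : ∀ {n} → List (Fin n) → List (Fin n × Fin n)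
pairs []       = []
pairs (a ∷ xs) = map (a ,_) xs ++ pairs xs

empty : ∀ {n} → Mate n
empty _ = nothing

probe : ∀ {n} → (Fin n → Fin n → Bool) → Mate n → Fin n × Fin n → Mate n
probe adj m (a , b) =
  if is-nothing (m a) ∧ is-nothing (m b) ∧ adj a b
  then (λ w → if ⌊ w ≟ a ⌋ then just b else if ⌊ w ≟ b ⌋ then just a else m w)
  else m

ranking : ∀ {n} → (Fin n → Fin n → Bool) → List (Fin n) → Mate n
ranking adj σ = foldl (probe adj) empty (pairs σ)

insertAt : ∀ {A : Set} → ℕ → A → List A → List A
insertAt zero    x ys       = x ∷ ys
insertAt (suc k) x []       = x ∷ []
insertAt (suc k) x (y ∷ ys) = y ∷ insertAt k x ys

-- sigma_u^i : remove u, reinsert it at rank i (i given 0-based as k, rank = k+1)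
reinsert : ∀ {n} → List (Fin n) → Fin n → ℕ → List (Fin n)
reinsert σ u k = insertAt k u (filter (λ w → ¬? (w ≟ u)) σ)
  where open import Relation.Nullary.Decidable using (¬?)

Matched : ∀ {n} → Mate n → Fin n → Set
Matched m v = ∃ λ w → m v ≡ just w

Unmatched : ∀ {n} → Mate n → Fin n → Set
Unmatched m v = m v ≡ nothing

data Rule : Set where
  R1 R2 R3 R4 R5 R6 : Rule

Applies : ∀ {n} → Rule → (Fin n → Fin n → Bool) → (Fin n → Fin n) →
          List (Fin n) → Fin n → List (Fin n) → Fin n → Set
Applies R1 adj star σ u τ x = Unmatched (ranking adj τ) u × x ≡ star u
Applies R2 adj star σ u τ x = Unmatched (ranking adj τ) u × ranking adj τ (star u) ≡ just x
Applies R3 adj star σ u τ x = Matched (ranking adj τ) u × x ≡ u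
Applies R4 adj star σ u τ x = ranking adj τ u ≡ just (star u) × x ≡ star u
Applies R5 adj star σ u τ x =
  Matched (ranking adj τ) u × ranking adj τ (star u) ≡ just x × x ≢ u
Applies R6 adj star σ u τ x =
  Matched (ranking adj τ) u × Unmatched (ranking adj τ) (star u)
  × ranking adj σ (star u) ≡ just x

ProducedBy : ∀ {n} → Rule → (Fin n → Fin n → Bool) → (Fin n → Fin n) →
             List (Fin n) → Fin n → List (Fin n) → Fin n → Set
ProducedBy {n} r adj star ρ x σ u =
  Σ (Fin n) λ i → ρ ≡ reinsert σ u (Data.Fin.toℕ i) × Applies r adj star σ u ρ x

-- A producer (σ , u) has u in last position, so σ is the order ρ induces on the other
-- nodes followed by u; it suffices to recover u from (ρ , x). Under R(1)-R(5), x is u, u*,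
-- or the ρ-partner of u*, which determines u. Under R(6), let π be ρ with u deleted.
-- Since u is last and unmatched in σ, M(σ) = M(π), so x is matched to u* in π. Deleting a
-- node from a ranking either leaves the matching unchanged or, if the node gets matched,
-- changes the set of free nodes at no more than one other node; here that node is u*, which
-- is free in ρ. So every other node a free in ρ is free in π, and if a is adjacent to x,
-- greediness of x's probes in π puts u* before a. Two R(6)-producers (σ₁ , u₁), (σ₂ , u₂)
-- would therefore put u₁* before u₂* and u₂* before u₁* in ρ.

module Submission where

open import Defs
open import Data.Bool using (Bool; true; false; _∧_; if_then_else_)
open import Data.Empty using (⊥-elim)
open import Data.Fin using (Fin; _≟_; toℕ)
open import Data.List using (List; []; _∷_; _++_; [_]; foldl; map; filter; allFin)
open import Data.List.Membership.Propositional using (_∈_; _∉_)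
open import Data.List.Membership.Propositional.Properties using (∈-allFin; ∈-filter⁺; ∈-++⁺ʳ)
open import Data.List.Properties using (foldl-++; filter-reject; filter-idem; filter-++; filter-all; ++-identityʳ)
open import Data.List.Relation.Binary.Permutation.Propositional using (_↭_; ↭-sym; ↭⇒↭ₛ)
open import Data.List.Relation.Binary.Permutation.Propositional.Properties using (∈-resp-↭)
open import Data.List.Relation.Binary.Permutation.Setoid.Properties using (Unique-resp-↭)
open import Data.List.Relation.Binary.Sublist.Propositional using (_⊆_; _∷_; _∷ʳ_; from∈; lookup; ⊆-trans)
open import Data.List.Relation.Binary.Sublist.Propositional.Properties using (filter-⊆)
open import Data.List.Relation.Unary.All as All using (All)
open import Data.List.Relation.Unary.All.Properties using (¬Any⇒All¬)
open import Data.List.Relation.Unary.AllPairs using (_∷_)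
open import Data.List.Relation.Unary.Any using (here; there)
open import Data.List.Relation.Unary.Unique.Propositional using (Unique)
open import Data.List.Relation.Unary.Unique.Propositional.Properties using (allFin⁺)
open import Data.Nat using (ℕ; zero; suc)
open import Data.Maybe using (Maybe; just; nothing; is-nothing)
open import Data.Maybe.Properties using (just-injective)
open import Data.Product using (_×_; _,_; ∃; proj₁; proj₂; map₂)
open import Data.Sum using (_⊎_; inj₁; inj₂; [_,_]′)
import Data.Sum as Sum
open import Function using (case_of_)
open import Relation.Nullary using (¬_; yes; no)
open import Relation.Nullary.Decidable using (⌊_⌋; ¬?)
open import Relation.Binary.PropositionalEquality
  using (_≡_; _≢_; refl; sym; trans; cong; cong₂; cong-app; subst; subst₂; module ≡-Reasoning)
open import Relation.Binary.PropositionalEquality.Properties using (setoid)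

Precedes : ∀ {A : Set} → List A → A → A → Set
Precedes xs a b = a ∷ b ∷ [] ⊆ xs

Precedes-antisym : ∀ {A : Set} {xs : List A} {a b} → Unique xs →
                   Precedes xs a b → Precedes xs b a → a ≡ b
Precedes-antisym _         (refl ∷ _) (refl ∷ _) = refl
Precedes-antisym (a∉ ∷ _)  (refl ∷ _) (_ ∷ʳ q)   = ⊥-elim (All.lookup a∉ (lookup q (there (here refl))) refl)
Precedes-antisym (b∉ ∷ _)  (_ ∷ʳ p)   (refl ∷ _) = ⊥-elim (All.lookup b∉ (lookup p (there (here refl))) refl)
Precedes-antisym (_ ∷ uq)  (_ ∷ʳ p)   (_ ∷ʳ q)   = Precedes-antisym uq p q

Unique-snoc⇒∉ : ∀ {A : Set} (xs : List A) {x} → Unique (xs ++ [ x ]) → x ∉ xs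
Unique-snoc⇒∉ (y ∷ ys) (y∉ ∷ _) (here refl) = All.lookup y∉ (∈-++⁺ʳ ys (here refl)) refl
Unique-snoc⇒∉ (y ∷ ys) (_ ∷ uq) (there x∈) = Unique-snoc⇒∉ ys uq x∈

↭allFin⇒Unique : ∀ {n} {xs : List (Fin n)} → xs ↭ allFin n → Unique xs
↭allFin⇒Unique {n} p = Unique-resp-↭ (setoid (Fin n)) (↭⇒↭ₛ (↭-sym p)) (allFin⁺ n)

↭allFin⇒∈ : ∀ {n} {xs : List (Fin n)} → xs ↭ allFin n → ∀ v → v ∈ xs
↭allFin⇒∈ p v = ∈-resp-↭ (↭-sym p) (∈-allFin v)

without : ∀ {n} → Fin n → List (Fin n) → List (Fin n)
without u = filter (λ w → ¬? (w ≟ u))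

module _ {n} (u : Fin n) where

  without-self : ∀ ys → without u (u ∷ ys) ≡ without u ys
  without-self ys = filter-reject (λ w → ¬? (w ≟ u)) (λ u≢u → u≢u refl)

  without-insertAt : ∀ k ys → without u (insertAt k u ys) ≡ without u ys
  without-insertAt zero    ys       = without-self ys
  without-insertAt (suc k) []       = without-self []
  without-insertAt (suc k) (y ∷ ys) with y ≟ u
  ... | yes _ = without-insertAt k ys
  ... | no  _ = cong (y ∷_) (without-insertAt k ys)

  without-reinsert : ∀ σ k → without u (reinsert σ u k) ≡ without u σ
  without-reinsert σ k =
    trans (without-insertAt k (without u σ)) (filter-idem (λ w → ¬? (w ≟ u)) σ)

  without-snoc : ∀ xs → u ∉ xs → without u (xs ++ [ u ]) ≡ xs
  without-snoc xs u∉xs = begin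
    without u (xs ++ [ u ])          ≡⟨ filter-++ (λ w → ¬? (w ≟ u)) xs [ u ] ⟩
    without u xs ++ without u [ u ]  ≡⟨ cong₂ _++_ (filter-all (λ w → ¬? (w ≟ u)) xs≢u) (without-self []) ⟩
    xs ++ []                         ≡⟨ ++-identityʳ xs ⟩
    xs                               ∎
    where
    open ≡-Reasoning
    xs≢u : All (λ w → ¬ w ≡ u) xs
    xs≢u = All.map (λ u≢w w≡u → u≢w (sym w≡u)) (¬Any⇒All¬ xs u∉xs)

reinsert-undo : ∀ {n} {σ ρ : List (Fin n)} {u pre k} → σ ↭ allFin n → σ ≡ pre ++ [ u ] →
                ρ ≡ reinsert σ u k → σ ≡ without u ρ ++ [ u ]
reinsert-undo {u = u} {pre} {k} σ↭ refl refl =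
  cong (_++ [ u ]) (sym (trans (without-reinsert u (pre ++ [ u ]) k)
                               (without-snoc u pre (Unique-snoc⇒∉ pre (↭allFin⇒Unique σ↭)))))

just≢nothing : ∀ {A : Set} {x : A} → just x ≢ nothing
just≢nothing ()

is-nothing⇒≡nothing : ∀ {A : Set} {x : Maybe A} → is-nothing x ≡ true → x ≡ nothing
is-nothing⇒≡nothing {x = nothing} _ = refl

free≢matched : ∀ {A : Set} {x y : Maybe A} → x ≡ nothing → is-nothing y ≡ false → is-nothing x ≢ is-nothing y
free≢matched refl y e with () ← trans e y

module Ranking {n : ℕ} (adj : Fin n → Fin n → Bool)
               (adj-sym : ∀ a b → adj a b ≡ adj b a) (adj-irrefl : ∀ a → adj a a ≡ false) where

  probeAll : Mate n → List (Fin n × Fin n) → Mate n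
  probeAll = foldl (probe adj)

  block : Mate n → Fin n → List (Fin n) → Mate n
  block m c ys = probeAll m (map (c ,_) ys)

  fires : Mate n → Fin n → Fin n → Bool
  fires m c d = is-nothing (m c) ∧ is-nothing (m d) ∧ adj c d

  module _ (m : Mate n) (c d : Fin n) where

    fires-dec : fires m c d ≡ false ⊎ fires m c d ≡ true
    fires-dec with fires m c d
    ... | false = inj₁ refl
    ... | true  = inj₂ refl

    probe-idle : fires m c d ≡ false → probe adj m (c , d) ≡ m
    probe-idle f rewrite f = refl

    probe-fires : fires m c d ≡ true → ∀ w →
      probe adj m (c , d) w ≡ (if ⌊ w ≟ c ⌋ then just d else if ⌊ w ≟ d ⌋ then just c else m w)
    probe-fires f w rewrite f = refl

    fires⇒free : fires m c d ≡ true → m c ≡ nothing × m d ≡ nothing × adj c d ≡ true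
    fires⇒free f with m c | m d | adj c d
    ... | nothing | nothing | true = refl , refl , refl

    fires⇒≢ : fires m c d ≡ true → c ≢ d
    fires⇒≢ f refl with () ← trans (sym (proj₂ (proj₂ (fires⇒free f)))) (adj-irrefl c)

    probe-left : fires m c d ≡ true → probe adj m (c , d) c ≡ just d
    probe-left f rewrite probe-fires f c with c ≟ c
    ... | yes _   = refl
    ... | no c≢c  = ⊥-elim (c≢c refl)

    probe-right : fires m c d ≡ true → probe adj m (c , d) d ≡ just c
    probe-right f rewrite probe-fires f d with d ≟ c | d ≟ d
    ... | yes d≡c | _       = ⊥-elim (fires⇒≢ f (sym d≡c))
    ... | no _    | yes _   = refl
    ... | no _    | no d≢d  = ⊥-elim (d≢d refl)

    fires-when-free : m c ≡ nothing → m d ≡ nothing → fires m c d ≡ adj c d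
    fires-when-free mc md rewrite mc | md = refl

    fires≡false⇒matched : adj c d ≡ true → fires m c d ≡ false →
                          is-nothing (m c) ≡ false ⊎ is-nothing (m d) ≡ false
    fires≡false⇒matched cd f with m c | m d
    ... | just _  | _       = inj₁ refl
    ... | nothing | just _  = inj₂ refl
    ... | nothing | nothing with () ← trans (sym cd) f

    probe-elsewhere : ∀ {w} → w ≢ c → w ≢ d → probe adj m (c , d) w ≡ m w
    probe-elsewhere {w} w≢c w≢d with fires m c d in f
    ... | false = refl
    ... | true with w ≟ c | w ≟ d
    ...   | yes w≡c | _       = ⊥-elim (w≢c w≡c)
    ...   | no _    | yes w≡d = ⊥-elim (w≢d w≡d)
    ...   | no _    | no _    = refl

    probe-keeps : ∀ {w v} → m w ≡ just v → probe adj m (c , d) w ≡ just v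
    probe-keeps {w} mw with fires-dec
    ... | inj₁ f = trans (cong-app (probe-idle f) w) mw
    ... | inj₂ f = trans (probe-elsewhere w≢c w≢d) mw
      where
      w≢c : w ≢ c
      w≢c refl = just≢nothing (trans (sym mw) (proj₁ (fires⇒free f)))
      w≢d : w ≢ d
      w≢d refl = just≢nothing (trans (sym mw) (proj₁ (proj₂ (fires⇒free f))))

  probeAll-keeps : ∀ ps {m w v} → m w ≡ just v → probeAll m ps w ≡ just v
  probeAll-keeps []             mw = mw
  probeAll-keeps ((c , d) ∷ ps) {m} mw = probeAll-keeps ps (probe-keeps m c d mw)

  probeAll-free⁻ : ∀ ps {m w} → probeAll m ps w ≡ nothing → m w ≡ nothing
  probeAll-free⁻ ps {m} {w} free with m w in mw
  ... | nothing = refl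
  ... | just v  = ⊥-elim (just≢nothing (trans (sym (probeAll-keeps ps mw)) free))

  IsMatching : Mate n → Set
  IsMatching m = ∀ {a b} → m a ≡ just b → m b ≡ just a × adj a b ≡ true

  isMatching-injective : ∀ {m a b x} → IsMatching m → m a ≡ just x → m b ≡ just x → a ≡ b
  isMatching-injective ok ax bx = just-injective (trans (sym (proj₁ (ok ax))) (proj₁ (ok bx)))

  probe-isMatching : ∀ {m c d} → IsMatching m → IsMatching (probe adj m (c , d))
  probe-isMatching {m} {c} {d} ok {a} {b} ab with fires-dec m c d
  ... | inj₁ f = subst IsMatching (sym (probe-idle m c d f)) ok ab
  ... | inj₂ f with fires⇒free m c d f | a ≟ c | a ≟ d
  ...   | _ , _ , cd | yes refl | _ with refl ← trans (sym ab) (probe-left m c d f) =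
          probe-right m c d f , cd
  ...   | _ , _ , cd | no _ | yes refl with refl ← trans (sym ab) (probe-right m c d f) =
          probe-left m c d f , trans (adj-sym a b) cd
  ...   | mc , md , _ | no a≢c | no a≢d
          with ba , ab′ ← ok (trans (sym (probe-elsewhere m c d a≢c a≢d)) ab) =
          trans (probe-elsewhere m c d b≢c b≢d) ba , ab′
    where
    b≢c : b ≢ c
    b≢c refl = just≢nothing (trans (sym ba) mc)
    b≢d : b ≢ d
    b≢d refl = just≢nothing (trans (sym ba) md)

  probeAll-isMatching : ∀ ps {m} → IsMatching m → IsMatching (probeAll m ps)
  probeAll-isMatching []             ok = ok
  probeAll-isMatching ((c , d) ∷ ps) ok = probeAll-isMatching ps (probe-isMatching ok)

  ranking-isMatching : ∀ σ → IsMatching (ranking adj σ)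
  ranking-isMatching σ = probeAll-isMatching (pairs σ) (λ ())

  AgreeFreeOutside : Fin n → Fin n → Mate n → Mate n → Set
  AgreeFreeOutside u o m m′ = ∀ w → w ≢ u → w ≢ o → is-nothing (m w) ≡ is-nothing (m′ w)

  data Removal (u : Fin n) (m : Mate n) : Mate n → Set where
    unchanged : Removal u m m
    shifted   : ∀ {m′} → Matched m u → ∃ (λ o → AgreeFreeOutside u o m m′) → Removal u m m′

  module _ {u : Fin n} where

    agree-sym : ∀ {o m m′} → AgreeFreeOutside u o m m′ → AgreeFreeOutside u o m′ m
    agree-sym ag w w≢u w≢o = sym (ag w w≢u w≢o)

    agree-witness : ∀ {o m m′ x} → AgreeFreeOutside u o m m′ → x ≢ u →
                    is-nothing (m x) ≢ is-nothing (m′ x) → x ≡ o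
    agree-witness {o} {x = x} ag x≢u differ with x ≟ o
    ... | yes x≡o = x≡o
    ... | no  x≢o = ⊥-elim (differ (ag x x≢u x≢o))

    agree-moves : ∀ {o c d m m′ m₁ m₁′} → AgreeFreeOutside u o m m′ → c ≡ o →
                  (∀ {w} → w ≢ c → w ≢ d → m₁ w ≡ m w) → (∀ {w} → w ≢ c → w ≢ d → m₁′ w ≡ m′ w) →
                  is-nothing (m₁ c) ≡ is-nothing (m₁′ c) → AgreeFreeOutside u d m₁ m₁′
    agree-moves {c = c} ag refl m₁≈m m₁′≈m′ at-c w w≢u w≢d with w ≟ c
    ... | yes refl = at-c
    ... | no  w≢c  = trans (cong is-nothing (m₁≈m w≢c w≢d))
                       (trans (ag w w≢u w≢c) (cong is-nothing (sym (m₁′≈m′ w≢c w≢d))))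

    agree-probe-one-fires : ∀ {o m m′ c d} → c ≢ u → d ≢ u → AgreeFreeOutside u o m m′ →
                fires m c d ≡ true → fires m′ c d ≡ false →
                ∃ λ o′ → AgreeFreeOutside u o′ (probe adj m (c , d)) (probe adj m′ (c , d))
    agree-probe-one-fires {m = m} {m′} {c} {d} c≢u d≢u ag f f′ =
      [ (λ m′c → d , agree-moves ag (agree-witness ag c≢u (free≢matched mc m′c))
                       (probe-elsewhere m c d) idle′ (matched-both (probe-left m c d f) m′c))
      , (λ m′d → c , agree-moves ag (agree-witness ag d≢u (free≢matched md m′d))
                       (λ w≢d w≢c → probe-elsewhere m c d w≢c w≢d) (λ w≢d w≢c → idle′ w≢c w≢d)
                       (matched-both (probe-right m c d f) m′d))
      ]′ (fires≡false⇒matched m′ c d cd f′)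
      where
      mc : m c ≡ nothing
      mc = proj₁ (fires⇒free m c d f)
      md : m d ≡ nothing
      md = proj₁ (proj₂ (fires⇒free m c d f))
      cd : adj c d ≡ true
      cd = proj₂ (proj₂ (fires⇒free m c d f))
      idle′ : ∀ {w} → w ≢ c → w ≢ d → probe adj m′ (c , d) w ≡ m′ w
      idle′ {w} _ _ = cong-app (probe-idle m′ c d f′) w
      matched-both : ∀ {x y} → probe adj m (c , d) x ≡ just y → is-nothing (m′ x) ≡ false →
                     is-nothing (probe adj m (c , d) x) ≡ is-nothing (probe adj m′ (c , d) x)
      matched-both {x} mx m′x =
        trans (cong is-nothing mx) (sym (trans (cong is-nothing (cong-app (probe-idle m′ c d f′) x)) m′x))

    agree-probe : ∀ {o m m′ c d} → c ≢ u → d ≢ u → AgreeFreeOutside u o m m′ →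
                  ∃ λ o′ → AgreeFreeOutside u o′ (probe adj m (c , d)) (probe adj m′ (c , d))
    agree-probe {o} {m} {m′} {c} {d} c≢u d≢u ag with fires-dec m c d | fires-dec m′ c d
    ... | inj₁ f | inj₁ f′ =
      o , subst₂ (AgreeFreeOutside u o) (sym (probe-idle m c d f)) (sym (probe-idle m′ c d f′)) ag
    ... | inj₂ f | inj₁ f′ = agree-probe-one-fires c≢u d≢u ag f f′
    ... | inj₁ f | inj₂ f′ = map₂ agree-sym (agree-probe-one-fires c≢u d≢u (agree-sym ag) f′ f)
    ... | inj₂ f | inj₂ f′ = o , both
      where
      both : AgreeFreeOutside u o (probe adj m (c , d)) (probe adj m′ (c , d))
      both w w≢u w≢o with w ≟ c | w ≟ d
      ... | yes refl | _        = cong is-nothing (trans (probe-left m c d f) (sym (probe-left m′ c d f′)))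
      ... | no _     | yes refl = cong is-nothing (trans (probe-right m c d f) (sym (probe-right m′ c d f′)))
      ... | no w≢c   | no w≢d   = trans (cong is-nothing (probe-elsewhere m c d w≢c w≢d))
          (trans (ag w w≢u w≢o) (cong is-nothing (sym (probe-elsewhere m′ c d w≢c w≢d))))

    removal-probe : ∀ {m m′ c d} → c ≢ u → d ≢ u → Removal u m m′ →
                    Removal u (probe adj m (c , d)) (probe adj m′ (c , d))
    removal-probe c≢u d≢u unchanged = unchanged
    removal-probe {m} {c = c} {d} c≢u d≢u (shifted (v , mu) (o , ag)) =
      shifted (v , probe-keeps m c d mu) (agree-probe c≢u d≢u ag)

    removal-probe-u : ∀ {m m′ c d} → c ≡ u ⊎ d ≡ u → Removal u m m′ → Removal u (probe adj m (c , d)) m′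
    removal-probe-u {m} {c = c} {d} u∈ r with fires-dec m c d
    ... | inj₁ f = subst (λ m₁ → Removal u m₁ _) (sym (probe-idle m c d f)) r
    removal-probe-u {m} {d = d} (inj₁ refl) unchanged | inj₂ f =
      shifted (d , probe-left m u d f) (d , λ w w≢u w≢d → cong is-nothing (probe-elsewhere m u d w≢u w≢d))
    removal-probe-u {m} {c = c} (inj₂ refl) unchanged | inj₂ f =
      shifted (c , probe-right m c u f) (c , λ w w≢u w≢c → cong is-nothing (probe-elsewhere m c u w≢c w≢u))
    removal-probe-u {m} {d = d} (inj₁ refl) (shifted (_ , mu) _) | inj₂ f =
      ⊥-elim (just≢nothing (trans (sym mu) (proj₁ (fires⇒free m u d f))))
    removal-probe-u {m} {c = c} (inj₂ refl) (shifted (_ , mu) _) | inj₂ f =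
      ⊥-elim (just≢nothing (trans (sym mu) (proj₁ (proj₂ (fires⇒free m c u f)))))

    removal-block-u : ∀ ys {m m′} → Removal u m m′ → Removal u (block m u ys) m′
    removal-block-u []       r = r
    removal-block-u (y ∷ ys) r = removal-block-u ys (removal-probe-u (inj₁ refl) r)

    removal-block : ∀ {x} → x ≢ u → ∀ ys {m m′} → Removal u m m′ →
                    Removal u (block m x ys) (block m′ x (without u ys))
    removal-block x≢u []       r = r
    removal-block x≢u (y ∷ ys) r with y ≟ u
    ... | yes refl = removal-block x≢u ys (removal-probe-u (inj₂ refl) r)
    ... | no  y≢u  = removal-block x≢u ys (removal-probe x≢u y≢u r)

    removal-pairs : ∀ xs {m m′} → Removal u m m′ →
                  Removal u (probeAll m (pairs xs)) (probeAll m′ (pairs (without u xs)))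
    removal-pairs []       r = r
    removal-pairs (x ∷ xs) {m} {m′} r
      rewrite foldl-++ (probe adj) m (map (x ,_) xs) (pairs xs) with x ≟ u
    ... | yes refl = removal-pairs xs (removal-block-u xs r)
    ... | no  x≢u
      rewrite foldl-++ (probe adj) m′ (map (x ,_) (without u xs)) (pairs (without u xs)) =
        removal-pairs xs (removal-block x≢u xs r)

  ranking-removal : ∀ u σ → Removal u (ranking adj σ) (ranking adj (without u σ))
  ranking-removal u σ = removal-pairs {u} σ unchanged

  removal-unmatched : ∀ {u m m′} → Removal u m m′ → m u ≡ nothing → m ≡ m′
  removal-unmatched unchanged            _  = refl
  removal-unmatched (shifted (_ , mu) _) un = ⊥-elim (just≢nothing (trans (sym mu) un))

  removal-keeps-free : ∀ {u m m′ s b} → Removal u m m′ → m s ≡ nothing → Matched m′ s → s ≢ u →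
                       m b ≡ nothing → b ≢ u → b ≢ s → m′ b ≡ nothing
  removal-keeps-free unchanged _ _ _ mb _ _ = mb
  removal-keeps-free {b = b} (shifted _ (o , ag)) ms (_ , m′s) s≢u mb b≢u b≢s =
    is-nothing⇒≡nothing (trans (sym (ag b b≢u b≢o)) (cong is-nothing mb))
    where
    b≢o : b ≢ o
    b≢o b≡o = b≢s (trans b≡o (sym (agree-witness ag s≢u (free≢matched ms (cong is-nothing m′s)))))

  probe-keeps-or-centre : ∀ m c y {w} → w ≢ c →
                           probe adj m (c , y) w ≡ m w ⊎ probe adj m (c , y) w ≡ just c
  probe-keeps-or-centre m c y {w} w≢c with w ≟ y
  ... | no w≢y = inj₁ (probe-elsewhere m c y w≢c w≢y)
  ... | yes refl with fires-dec m c w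
  ...   | inj₁ f = inj₁ (cong-app (probe-idle m c w f) w)
  ...   | inj₂ f = inj₂ (probe-right m c w f)

  block-keeps-or-centre : ∀ ys m c {w} → w ≢ c → block m c ys w ≡ m w ⊎ block m c ys w ≡ just c
  block-keeps-or-centre []       m c w≢c = inj₁ refl
  block-keeps-or-centre (y ∷ ys) m c w≢c with block-keeps-or-centre ys (probe adj m (c , y)) c w≢c
  ... | inj₂ e = inj₂ e
  ... | inj₁ e = Sum.map (trans e) (trans e) (probe-keeps-or-centre m c y w≢c)

  block-skips : ∀ ys {m c d} → m c ≡ nothing → block m c ys c ≡ nothing →
                d ∈ ys → m d ≡ nothing → adj c d ≡ false
  block-skips (y ∷ ys) {m} {c} mc bc d∈ md with fires-dec m c y
  ... | inj₂ f = ⊥-elim (just≢nothing (trans (sym (probeAll-keeps (map (c ,_) ys) (probe-left m c y f))) bc))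
  ... | inj₁ f with d∈
  ...   | here refl = trans (sym (fires-when-free m c y mc md)) f
  ...   | there d∈′ = block-skips ys (trans (cong-app (probe-idle m c y f) c) mc) bc d∈′
                                     (trans (cong-app (probe-idle m c y f) _) md)

  block-first : ∀ ys {m c a b} → m c ≡ nothing → block m c ys c ≡ just a → b ∈ ys →
                block m c ys b ≡ nothing → adj c b ≡ true → Precedes ys a b
  block-first (y ∷ ys) {m} {c} mc ca b∈ bb cb with fires-dec m c y
  ... | inj₂ f with refl ← trans (sym (probeAll-keeps (map (c ,_) ys) (probe-left m c y f))) ca
    with b∈
  ...   | here refl = ⊥-elim (just≢nothing (trans (sym (probeAll-keeps (map (c ,_) ys) (probe-right m c y f))) bb))
  ...   | there b∈′ = refl ∷ from∈ b∈′
  block-first (y ∷ ys) {m} {c} mc ca b∈ bb cb | inj₁ f with b∈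
  ...   | here refl = case trans (sym cb) (trans (sym (fires-when-free m c y mc mb)) f) of λ ()
    where
    mb : m y ≡ nothing
    mb = trans (sym (cong-app (probe-idle m c y f) y)) (probeAll-free⁻ (map (c ,_) ys) bb)
  ...   | there b∈′ = y ∷ʳ block-first ys (trans (cong-app (probe-idle m c y f) c) mc) ca b∈′ bb cb

  mate-precedes-free-neighbour : ∀ xs {m x a b} → m x ≡ nothing → x ∈ xs → b ∈ xs →
                                 probeAll m (pairs xs) x ≡ just a → probeAll m (pairs xs) b ≡ nothing →
                                 adj x b ≡ true → Precedes xs a b
  mate-precedes-free-neighbour (c ∷ xs) {m} {x} {a} {b} mx x∈ b∈ xa fb xb
    rewrite foldl-++ (probe adj) m (map (c ,_) xs) (pairs xs)
    with b₁ ← probeAll-free⁻ (pairs xs) fb | x ≟ c | x∈ | b∈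
  ... | no x≢c | here x≡c  | _ = ⊥-elim (x≢c x≡c)
  ... | no x≢c | there x∈′ | here refl =
    case trans (sym xb) (trans (adj-sym x b) (block-skips xs (probeAll-free⁻ (map (b ,_) xs) b₁) b₁ x∈′ mx))
    of λ ()
  ... | yes refl | _ | here refl = case trans (sym xb) (adj-irrefl x) of λ ()
  ... | yes refl | _ | there b∈′ with block m x xs x in e
  ...   | nothing = case trans (sym xb) (block-skips xs mx e b∈′ (probeAll-free⁻ (map (x ,_) xs) b₁)) of λ ()
  ...   | just a′ with refl ← trans (sym (probeAll-keeps (pairs xs) e)) xa =
          x ∷ʳ block-first xs mx e b∈′ b₁ xb
  mate-precedes-free-neighbour (c ∷ xs) {m} mx _ _ xa fb xb | no x≢c | there x∈′ | there b∈′
    with block-keeps-or-centre xs m c x≢c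
  ... | inj₁ e = c ∷ʳ mate-precedes-free-neighbour xs (trans e mx) x∈′ b∈′ xa fb xb
  ... | inj₂ e with refl ← trans (sym (probeAll-keeps (pairs xs) e)) xa = refl ∷ from∈ b∈′

  partner-precedes-free-neighbour :
    ∀ σ {ρ u s x a} → without u σ ≡ without u ρ → (∀ v → v ∈ ρ) →
    Unmatched (ranking adj σ) u → Matched (ranking adj ρ) u → s ≢ u →
    ranking adj σ s ≡ just x → Unmatched (ranking adj ρ) s →
    Unmatched (ranking adj ρ) a → adj x a ≡ true → a ≢ s → Precedes ρ s a
  partner-precedes-free-neighbour σ {ρ} {u} {s} {x} {a} same ρ-all σu (_ , ρu) s≢u σs ρs ρa xa a≢s =
    ⊆-trans (mate-precedes-free-neighbour π refl (∈π x≢u) (∈π a≢u) πx πa xa)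
            (filter-⊆ (λ w → ¬? (w ≟ u)) ρ)
    where
    π : List (Fin n)
    π = without u ρ
    ∈π : ∀ {v} → v ≢ u → v ∈ π
    ∈π {v} v≢u = ∈-filter⁺ (λ w → ¬? (w ≟ u)) (ρ-all v) v≢u
    x≢u : x ≢ u
    x≢u refl = just≢nothing (trans (sym (proj₁ (ranking-isMatching σ σs))) σu)
    a≢u : a ≢ u
    a≢u refl = just≢nothing (trans (sym ρu) ρa)
    σ≡π : ranking adj σ ≡ ranking adj π
    σ≡π = trans (removal-unmatched (ranking-removal u σ) σu) (cong (ranking adj) same)
    πs : ranking adj π s ≡ just x
    πs = trans (cong-app (sym σ≡π) s) σs
    πx : ranking adj π x ≡ just s
    πx = proj₁ (ranking-isMatching π πs)
    πa : ranking adj π a ≡ nothing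
    πa = removal-keeps-free (ranking-removal u ρ) ρs (x , πs) s≢u ρa a≢u a≢s

  module _ (star : Fin n → Fin n) (star-invol : ∀ u → star (star u) ≡ u) (star-≢ : ∀ u → star u ≢ u) where

    star-injective : ∀ {a b} → star a ≡ star b → a ≡ b
    star-injective {a} {b} e = trans (sym (star-invol a)) (trans (cong star e) (star-invol b))

    producer-node-unique : ∀ r {ρ x} → ρ ↭ allFin n →
                    ∀ σ₁ u₁ → without u₁ σ₁ ≡ without u₁ ρ → Unmatched (ranking adj σ₁) u₁ →
                    ∀ σ₂ u₂ → without u₂ σ₂ ≡ without u₂ ρ → Unmatched (ranking adj σ₂) u₂ →
                    Applies r adj star σ₁ u₁ ρ x → Applies r adj star σ₂ u₂ ρ x → u₁ ≡ u₂
    producer-node-unique R1 _ _ _ _ _ _ _ _ _ (_ , x≡) (_ , x≡′) = star-injective (trans (sym x≡) x≡′)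
    producer-node-unique R2 {ρ} _ _ _ _ _ _ _ _ _ (_ , s₁x) (_ , s₂x) =
      star-injective (isMatching-injective (ranking-isMatching ρ) s₁x s₂x)
    producer-node-unique R3 _ _ _ _ _ _ _ _ _ (_ , x≡) (_ , x≡′) = trans (sym x≡) x≡′
    producer-node-unique R4 _ _ _ _ _ _ _ _ _ (_ , x≡) (_ , x≡′) = star-injective (trans (sym x≡) x≡′)
    producer-node-unique R5 {ρ} _ _ _ _ _ _ _ _ _ (_ , s₁x , _) (_ , s₂x , _) =
      star-injective (isMatching-injective (ranking-isMatching ρ) s₁x s₂x)
    producer-node-unique R6 {ρ} {x} ρ↭ σ₁ u₁ same₁ σ₁u₁ σ₂ u₂ same₂ σ₂u₂
                         (ρu₁ , ρs₁ , σs₁) (ρu₂ , ρs₂ , σs₂)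
      with star u₁ ≟ star u₂
    ... | yes s₁≡s₂ = star-injective s₁≡s₂
    ... | no  s₁≢s₂ = ⊥-elim (s₁≢s₂ (Precedes-antisym (↭allFin⇒Unique ρ↭)
        (partner-precedes-free-neighbour σ₁ same₁ (↭allFin⇒∈ ρ↭) σ₁u₁ ρu₁ (star-≢ u₁) σs₁ ρs₁ ρs₂
           (neighbour σ₂ σs₂) (λ e → s₁≢s₂ (sym e)))
        (partner-precedes-free-neighbour σ₂ same₂ (↭allFin⇒∈ ρ↭) σ₂u₂ ρu₂ (star-≢ u₂) σs₂ ρs₂ ρs₁
           (neighbour σ₁ σs₁) s₁≢s₂)))
      where
      neighbour : ∀ σ {s} → ranking adj σ s ≡ just x → adj x s ≡ true
      neighbour σ {s} σs = trans (adj-sym x s) (proj₂ (ranking-isMatching σ σs))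

lemma4 : (n : ℕ) (adj : Fin n → Fin n → Bool)
    → (∀ a b → adj a b ≡ adj b a) → (∀ a → adj a a ≡ false)
    → (star : Fin n → Fin n)
    → (∀ u → star (star u) ≡ u) → (∀ u → star u ≢ u) → (∀ u → adj u (star u) ≡ true)
    → (r : Rule) (ρ : List (Fin n)) (x : Fin n)
    → ρ ↭ allFin n → Matched (ranking adj ρ) x
    → (σ₁ : List (Fin n)) (u₁ : Fin n) → σ₁ ↭ allFin n
    → (∃ λ pre → σ₁ ≡ pre ++ u₁ ∷ []) → Unmatched (ranking adj σ₁) u₁
    → (σ₂ : List (Fin n)) (u₂ : Fin n) → σ₂ ↭ allFin n
    → (∃ λ pre → σ₂ ≡ pre ++ u₂ ∷ []) → Unmatched (ranking adj σ₂) u₂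
    → ProducedBy r adj star ρ x σ₁ u₁ → ProducedBy r adj star ρ x σ₂ u₂
    → σ₁ ≡ σ₂ × u₁ ≡ u₂
lemma4 n adj adj-sym adj-irrefl star star-invol star-≢ _ r ρ x ρ↭ _
       σ₁ u₁ σ₁↭ (_ , σ₁≡) σ₁u₁ σ₂ u₂ σ₂↭ (_ , σ₂≡) σ₂u₂ (i₁ , ρ≡₁ , app₁) (i₂ , ρ≡₂ , app₂) =
  σ₁≡σ₂ , u₁≡u₂
  where
  open Ranking adj adj-sym adj-irrefl using (producer-node-unique)
  same : ∀ σ u (i : Fin n) → ρ ≡ reinsert σ u (toℕ i) → without u σ ≡ without u ρ
  same σ u i refl = sym (without-reinsert u σ (toℕ i))
  u₁≡u₂ : u₁ ≡ u₂
  u₁≡u₂ = producer-node-unique star star-invol star-≢ r ρ↭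
            σ₁ u₁ (same σ₁ u₁ i₁ ρ≡₁) σ₁u₁ σ₂ u₂ (same σ₂ u₂ i₂ ρ≡₂) σ₂u₂ app₁ app₂
  σ₁≡σ₂ : σ₁ ≡ σ₂
  σ₁≡σ₂ = begin
    σ₁                     ≡⟨ reinsert-undo σ₁↭ σ₁≡ ρ≡₁ ⟩
    without u₁ ρ ++ [ u₁ ] ≡⟨ cong (λ u → without u ρ ++ [ u ]) u₁≡u₂ ⟩
    without u₂ ρ ++ [ u₂ ] ≡⟨ reinsert-undo σ₂↭ σ₂≡ ρ≡₂ ⟨
    σ₂                     ∎
    where open ≡-Reasoning
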